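{- Let $P=(D,C)$ be a program of Core Choreographies that is strongly projectable, let $s$ be a state, and suppose $(P,s)\xrightarrow{\lambda}(P',s')$ for some observable label $\lambda$, program $P'$ and state $s'$. Then there exist a process program $N$ and an observable label $\lambda'$ such that $(\mathrm{epp}(P),s)\xrightarrow{\lambda'}(N,s')$ in the process semantics, the set of procedure definitions of $N$ equals that of $\mathrm{epp}(P)$, and, if $P'$ is projectable, then the network of $N$ is above the network of $\mathrm{epp}(P')$ in the branching order, i.e. $\mathrm{Net}(N)\succeq \mathrm{Net}(\mathrm{epp}(P'))$.
   Context: Fix types with decidable equality of process names $\mathsf{Pid}$, variables $\mathsf{Var}$, values $\mathsf{Val}$, expressions $\mathsf{Expr}$, Boolean expressions $\mathsf{BExpr}$, procedure names $\mathsf{RecVar}$, annotations $\mathsf{Ann}$, and evaluation functions $\mathrm{eval}:\mathsf{Expr}\times(\mathsf{Var}\to\mathsf{Val})\to\mathsf{Val}$, $\mathrm{beval}:\mathsf{BExpr}\times(\mathsf{Var}\to\mathsf{Val})\to\{\mathrm{true},\mathrm{false}\}$, invariant under extensional equality of their second argument. Labels are $\mathsf{left},\mathsf{right}$. A state is $s:\mathsf{Pid}\to\mathsf{Var}\to\mathsf{Val}$; $s\equiv s'$ means extensional equality; $s[q,x\mapsto v]$ updates $q$'s variable $x$ to $v$. Choreographies: interactions $\eta::=p.e\to q.x\mid p\to q[l]$ (processes of $\eta$: $\{p,q\}$); $C::=\eta@a;C\mid \mathsf{if}\ p.b\ \mathsf{then}\ C_1\ \mathsf{else}\ C_2\mid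 \mathsf{call}\ X\mid \mathsf{rtcall}\ X\ ps\ C\mid\mathsf{end}$ with $ps$ a list of processes. A definition set is $D:\mathsf{RecVar}\to\mathrm{list}(\mathsf{Pid})\times\mathsf{Chor}$, $D\,X=(\mathrm{Vars}\,X,\mathrm{Body}\,X)$; a program is a pair $(D,C)$ (Procedures, Main). Rich labels: $\mathrm{com}(p,v,q,x)$, $\mathrm{sel}(p,q,l)$, $\mathrm{cond}(p)$, $\mathrm{call}(X,p)$, with processes $\{p,q\},\{p,q\},\{p\},\{p\}$. The relation $\langle C,s\rangle\xrightarrow{\rho}_D\langle C',s'\rangle$ is inductively defined by: $\langle p.e\to q.x@a;C,s\rangle\xrightarrow{\mathrm{com}(p,v,q,x)}\langle C,s'\rangle$ if $v=\mathrm{eval}(e,s\,p)$, $s'\equiv s[q,x\mapsto v]$; $\langle p\to q[l]@a;C,s\rangle\xrightarrow{\mathrm{sel}(p,q,l)}\langle C,s'\rangle$ if $s\equiv s'$; $\langle\mathsf{if}\ p.b\ \mathsf{then}\ C_1\ \mathsf{else}\ C_2,s\rangle\xrightarrow{\mathrm{cond}(p)}\langle C_1,s'\rangle$ (resp. $C_2$) if $\mathrm{beval}(b,s\,p)=\mathrm{true}$ (resp. false) and $s\equiv s'$; $\langle \eta@a;C,s\rangle\xrightarrow{\rho}\langle\eta@a;C',s'\rangle$ if $\langle C,s\rangle\xrightarrow{\rho}\langle C',s'\rangle$ and the processes of $\eta$ and $\rho$ are disjoint; $\langle\mathsf{if}\ p.b\ \mathsf{then}\ C_1\ \mathsf{else}\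 C_2,s\rangle\xrightarrow{\rho}\langle\mathsf{if}\ p.b\ \mathsf{then}\ C_1'\ \mathsf{else}\ C_2',s'\rangle$ if $p$ is not a process of $\rho$ and $\langle C_i,s\rangle\xrightarrow{\rho}\langle C_i',s'\rangle$ for $i=1,2$; $\langle\mathsf{rtcall}\ X\ ps\ C,s\rangle\xrightarrow{\rho}\langle\mathsf{rtcall}\ X\ ps\ C',s'\rangle$ if no process of $\rho$ is in $ps$ and $\langle C,s\rangle\xrightarrow{\rho}\langle C',s'\rangle$; for $s\equiv s'$ and $p\in\mathrm{Vars}\,X$: $\langle\mathsf{call}\ X,s\rangle\xrightarrow{\mathrm{call}(X,p)}\langle\mathrm{Body}\,X,s'\rangle$ if $\#\mathrm{Vars}\,X=1$, and $\to\langle\mathsf{rtcall}\ X\ (\mathrm{Vars}\,X\setminus p)\ (\mathrm{Body}\,X),s'\rangle$ if $\#\mathrm{Vars}\,X>1$; for $s\equiv s'$, $p\in ps$: $\langle\mathsf{rtcall}\ X\ ps\ C,s\rangle\xrightarrow{\mathrm{call}(X,p)}\langle\mathsf{rtcall}\ X\ (ps\setminus p)\ C,s'\rangle$ if $\#ps>1$, and $\to\langle C,s'\rangle$ if $\#ps=1$ ($\#$ = size of list, $ps\setminus p$ = removal of $p$). Observable labels: $\mathrm{forget}$ maps $\mathrm{com}(p,v,q,x)\mapsto \mathrm{com}(p,v,q)$, $\mathrm{sel}\mapsto\mathrm{sel}$, $\mathrm{cond}(p),\mathrm{call}(X,p)\mapsto\tau(p)$; $((D,C),s)\xrightarrow{\mathrm{forget}(\rho)}((D,C'),s')$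 iff $\langle C,s\rangle\xrightarrow{\rho}_D\langle C',s'\rangle$. Well-formedness $\mathrm{WF}(D,C)$: $C$ has no self-interaction ($p.e\to p.x$ or $p\to p[l]$), every $\mathsf{rtcall}\ X\ ps\ C'$ in $C$ has $ps$ nonempty and $ps\subseteq\mathrm{Vars}\,X$; and for every $X$: $\mathrm{Body}\,X$ has no self-interaction and no $\mathsf{rtcall}$, $\mathrm{Vars}\,X\neq\emptyset$, and $\mathrm{pn}(\mathrm{Body}\,X)\subseteq\mathrm{Vars}\,X$, where $\mathrm{pn}(\eta@a;C)=\mathrm{procs}(\eta)\cup\mathrm{pn}(C)$, $\mathrm{pn}(\mathsf{if}\ p.b\dots)=\{p\}\cup\mathrm{pn}(C_1)\cup\mathrm{pn}(C_2)$, $\mathrm{pn}(\mathsf{call}\ X)=\mathrm{Vars}\,X$, $\mathrm{pn}(\mathsf{rtcall}\ X\ ps\ C)=ps\cup\mathrm{pn}(C)$, $\mathrm{pn}(\mathsf{end})=\emptyset$. Behaviours: $B::=\mathsf{end}\mid q!e@a;B\mid q?x@a;B\mid q\oplus l@a;B\mid q\,\&\,m_1/\!/m_2\mid\mathsf{if}\ b\ \mathsf{then}\ B_1\ \mathsf{else}\ B_2\mid\mathsf{call}\ Y$ with $m_i\in\{\mathrm{None}\}\cup\{\mathrm{Some}(a,B)\}$ and $Y\in\mathsf{RecVar}\times\mathsf{Pid}$. Branching order $B\succeq B'$: inductively, $\mathsf{end}\succeq\mathsf{end}$, $\mathsf{call}\ Y\succeq\mathsf{call}\ Y$, prefixes $q!e@a;\cdot$,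 $q?x@a;\cdot$, $q\oplus l@a;\cdot$ and $\mathsf{if}\ b$ are congruences (same prefix/guard, componentwise $\succeq$), and $q\,\&\,m_l/\!/m_r\succeq q\,\&\,m_l'/\!/m_r'$ iff for each side, $m'=\mathrm{None}$, or $m'=\mathrm{Some}(a,B')$ and $m=\mathrm{Some}(a,B)$ with $B\succeq B'$. Merge $B_1\sqcup B_2=B$ (a relation): $\mathsf{end}\sqcup\mathsf{end}=\mathsf{end}$, $\mathsf{call}\ Y\sqcup\mathsf{call}\ Y=\mathsf{call}\ Y$; $\pi;B_1\sqcup\pi;B_2=\pi;B$ for identical prefixes $\pi$ (send, receive, selection, with annotation) when $B_1\sqcup B_2=B$; $\mathsf{if}\ b\ \mathsf{then}\ B_1\ \mathsf{else}\ B_2\sqcup\mathsf{if}\ b\ \mathsf{then}\ B_1'\ \mathsf{else}\ B_2'=\mathsf{if}\ b\ \mathsf{then}\ B_1''\ \mathsf{else}\ B_2''$ when $B_i\sqcup B_i'=B_i''$; $q\,\&\,m_l/\!/m_r\sqcup q\,\&\,m_l'/\!/m_r'=q\,\&\,m_l''/\!/m_r''$ where on each side: None,None$\mapsto$None; Some$(a,B)$,None$\mapsto$Some$(a,B)$; None,Some$(a,B)\mapsto$Some$(a,B)$; Some$(a,B_1)$,Some$(a,B_2)\mapsto$Some$(a,B)$ when $B_1\sqcup B_2=B$. No other clauses. Projection $[\![D,C\mid r]\!]=B$ (relation): $[\![D,\mathsf{end}\mid r]\!]=\mathsf{end}$; for $p.e\to q.x@a;C$ with $[\![D,C\mid r]\!]=B$: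 gives $q!e@a;B$ if $r=p$, $p?x@a;B$ if $r=q\ne p$, $B$ if $r\notin\{p,q\}$; for $p\to q[l]@a;C$: $q\oplus l@a;B$ if $r=p$; if $r=q\neq p$, $p\,\&\,\mathrm{Some}(a,B)/\!/\mathrm{None}$ for $l=\mathsf{left}$ and $p\,\&\,\mathrm{None}/\!/\mathrm{Some}(a,B)$ for $l=\mathsf{right}$; $B$ if $r\notin\{p,q\}$; $[\![D,\mathsf{if}\ p.b\ \mathsf{then}\ C_1\ \mathsf{else}\ C_2\mid p]\!]=\mathsf{if}\ b\ \mathsf{then}\ B_1\ \mathsf{else}\ B_2$ and, for $r\ne p$, $=B$ with $B_1\sqcup B_2=B$, where $B_i=[\![D,C_i\mid r]\!]$; $[\![D,\mathsf{call}\ X\mid r]\!]=\mathsf{call}(X,r)$ if $r\in\mathrm{Vars}\,X$, else $\mathsf{end}$; $[\![D,\mathsf{rtcall}\ X\ ps\ C\mid r]\!]=\mathsf{call}(X,r)$ if $r\in ps$, else $[\![D,C\mid r]\!]$. $C$ is projectable on $r$ if some $B$ exists; $D$ is projectable if each $\mathrm{Body}\,X$ is projectable on every $r\in\mathrm{Vars}\,X$; $(D,C)$ is projectable if $D$ is and $C$ is projectable on every $r\in\mathrm{pn}(C)$. Then $\mathrm{epp}(D,C)=(D^\flat,N_C)$ with $D^\flat(X,r)=[\![D,\mathrm{Body}\,X\mid r]\!]$ if $r\in\mathrm{Vars}\,X$ and $\mathsf{end}$ otherwise, and $N_C(r)=[\![D,C\mid r]\!]$ for $r\in\mathrm{pn}(C)$,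 $\mathsf{end}$ otherwise; $\mathrm{Net}$ is the network component, and $N\succeq N'$ means pointwise $\succeq$. Strong projectability $\mathrm{sp}(D,C,r)$: $\mathrm{sp}(D,\eta@a;C',r)=\mathrm{sp}(D,C',r)$; for $\mathsf{if}$: $\mathrm{sp}(D,C_1,r)\wedge\mathrm{sp}(D,C_2,r)\wedge$ the conditional is projectable on $r$; $\mathrm{sp}(D,\mathsf{rtcall}\ X\ ps\ C',r)$: $\mathrm{sp}(D,C',r)$ and for all $p\in ps$ and all $B,B'$ with $[\![D,\mathrm{Body}\,X\mid p]\!]=B$, $[\![D,C'\mid p]\!]=B'$, $B\succeq B'$; otherwise true. $(D,C)$ is strongly projectable if it is well-formed, $D$ is projectable, and $\mathrm{sp}(D,C,r)$ for all $r$. Process semantics: a network is $N:\mathsf{Pid}\to\mathsf{Behaviour}$, $N\equiv N'$ pointwise equality; a process program is $(D^\flat,N)$ with $D^\flat:\mathsf{RecVar}\times\mathsf{Pid}\to\mathsf{Behaviour}$. $\langle N,s\rangle\xrightarrow{\rho}_{D^\flat}\langle N',s'\rangle$: $\mathrm{com}(p,v,q,x)$ if $N\,p=q!e@a;B$, $N\,q=p?x@a';B'$, $v=\mathrm{eval}(e,s\,p)$, $N'\equiv N[p\mapsto B,q\mapsto B']$, $s'\equiv s[q,x\mapsto v]$; $\mathrm{sel}(p,q,\mathsf{left})$ if $N\,p=q\oplus\mathsf{left}@a;B$, $N\,q=p\,\&\,\mathrm{Some}(a',B_l)/\!/m_r$, $N'\equiv N[p\mapsto B,q\mapsto B_l]$,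 $s\equiv s'$ (symmetrically for $\mathsf{right}$); $\mathrm{cond}(p)$ if $N\,p=\mathsf{if}\ b\ \mathsf{then}\ B_1\ \mathsf{else}\ B_2$, $N'\equiv N[p\mapsto B_1]$ or $N[p\mapsto B_2]$ according to $\mathrm{beval}(b,s\,p)$, $s\equiv s'$; $\mathrm{call}(Y,p)$ if $N\,p=\mathsf{call}\ Y$, $N'\equiv N[p\mapsto D^\flat Y]$, $s\equiv s'$. Configuration steps $((D^\flat,N),s)\xrightarrow{\mathrm{forget}(\rho)}((D^\flat,N'),s')$. -}

module Defs where

open import Data.Bool using (Bool; true; false; _∧_)
open import Data.Nat using (ℕ; _>_)
open import Data.List using (List; []; _∷_; _++_; length; filter)
open import Data.List.Membership.Propositional using (_∈_; _∉_)
open import Data.List.Relation.Binary.Subset.Propositional using (_⊆_)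
open import Data.Maybe using (Maybe; just; nothing)
open import Data.Product using (Σ; ∃; _×_; _,_; proj₁; proj₂)
open import Data.Unit using (⊤)
open import Relation.Binary.PropositionalEquality using (_≡_; _≢_)
open import Relation.Binary.Definitions using (DecidableEquality)
open import Relation.Nullary using (¬_; does)
open import Relation.Nullary.Decidable using (⌊_⌋)

record Sig : Set₁ where
  field
    Pid Var Val Expr BExpr RecVar Ann : Set
    _≟Pid_ : DecidableEquality Pid
    _≟Var_ : DecidableEquality Var
    _≟Val_ : DecidableEquality Val
    _≟Expr_ : DecidableEquality Expr
    _≟BExpr_ : DecidableEquality BExpr
    _≟RecVar_ : DecidableEquality RecVar
    _≟Ann_ : DecidableEquality Ann
    eval : Expr → (Var → Val) → Val
    beval : BExpr → (Var → Val) → Bool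
    eval-ext : ∀ e (f g : Var → Val) → (∀ x → f x ≡ g x) → eval e f ≡ eval e g
    beval-ext : ∀ b (f g : Var → Val) → (∀ x → f x ≡ g x) → beval b f ≡ beval b g

module Theory (σ : Sig) where
  open Sig σ public

  State : Set
  State = Pid → Var → Val

  _≡S_ : State → State → Set
  s ≡S s' = ∀ p x → s p x ≡ s' p x

  update : State → Pid → Var → Val → State
  update s q x v p y with p ≟Pid q | y ≟Var x
  ... | Relation.Nullary.yes _ | Relation.Nullary.yes _ = v
  ... | _ | _ = s p y

  data Label : Set where
    left right : Label

  data Interaction : Set where
    icom : Pid → Expr → Pid → Var → Interaction
    isel : Pid → Pid → Label → Interaction

  procsI : Interaction → List Pid
  procsI (icom p _ q _) = p ∷ q ∷ []
  procsI (isel p q _) = p ∷ q ∷ []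

  infixr 5 _at_⨾_
  data Chor : Set where
    _at_⨾_ : Interaction → Ann → Chor → Chor
    cif : Pid → BExpr → Chor → Chor → Chor
    call : RecVar → Chor
    rtcall : RecVar → List Pid → Chor → Chor
    end : Chor

  DefSet : Set
  DefSet = RecVar → List Pid × Chor

  Vars : DefSet → RecVar → List Pid
  Vars D X = proj₁ (D X)

  Body : DefSet → RecVar → Chor
  Body D X = proj₂ (D X)

  Program : Set
  Program = DefSet × Chor

  remove : Pid → List Pid → List Pid
  remove p ps = filter (λ q → ¬? (q ≟Pid p)) ps
    where open import Relation.Nullary using (¬?)

  data RichLabel : Set where
    rcom : Pid → Val → Pid → Var → RichLabel
    rsel : Pid → Pid → Label → RichLabel
    rcond : Pid → RichLabel
    rcall : RecVar → Pid → RichLabel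

  procsR : RichLabel → List Pid
  procsR (rcom p _ q _) = p ∷ q ∷ []
  procsR (rsel p q _) = p ∷ q ∷ []
  procsR (rcond p) = p ∷ []
  procsR (rcall _ p) = p ∷ []

  data CStep (D : DefSet) : Chor → State → RichLabel → Chor → State → Set where
    s-com : ∀ {p e q x a C s s' v} → v ≡ eval e (s p) → s' ≡S update s q x v →
            CStep D (icom p e q x at a ⨾ C) s (rcom p v q x) C s'
    s-sel : ∀ {p q l a C s s'} → s ≡S s' →
            CStep D (isel p q l at a ⨾ C) s (rsel p q l) C s'
    s-then : ∀ {p b C₁ C₂ s s'} → beval b (s p) ≡ true → s ≡S s' →
            CStep D (cif p b C₁ C₂) s (rcond p) C₁ s'
    s-else : ∀ {p b C₁ C₂ s s'} → beval b (s p) ≡ false → s ≡S s' →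
            CStep D (cif p b C₁ C₂) s (rcond p) C₂ s'
    s-delay : ∀ {η a C C' s s' ρ} → CStep D C s ρ C' s' →
            (∀ r → r ∈ procsI η → r ∉ procsR ρ) →
            CStep D (η at a ⨾ C) s ρ (η at a ⨾ C') s'
    s-delay-if : ∀ {p b C₁ C₂ C₁' C₂' s s' ρ} → p ∉ procsR ρ →
            CStep D C₁ s ρ C₁' s' → CStep D C₂ s ρ C₂' s' →
            CStep D (cif p b C₁ C₂) s ρ (cif p b C₁' C₂') s'
    s-delay-rt : ∀ {X ps C C' s s' ρ} → (∀ r → r ∈ procsR ρ → r ∉ ps) →
            CStep D C s ρ C' s' →
            CStep D (rtcall X ps C) s ρ (rtcall X ps C') s'
    s-call-one : ∀ {X p s s'} → s ≡S s' → p ∈ Vars D X → length (Vars D X) ≡ 1 →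
            CStep D (call X) s (rcall X p) (Body D X) s'
    s-call-many : ∀ {X p s s'} → s ≡S s' → p ∈ Vars D X → length (Vars D X) > 1 →
            CStep D (call X) s (rcall X p) (rtcall X (remove p (Vars D X)) (Body D X)) s'
    s-rt-many : ∀ {X ps C p s s'} → s ≡S s' → p ∈ ps → length ps > 1 →
            CStep D (rtcall X ps C) s (rcall X p) (rtcall X (remove p ps) C) s'
    s-rt-one : ∀ {X ps C p s s'} → s ≡S s' → p ∈ ps → length ps ≡ 1 →
            CStep D (rtcall X ps C) s (rcall X p) C s'

  data ObsLabel : Set where
    ocom : Pid → Val → Pid → ObsLabel
    osel : Pid → Pid → Label → ObsLabel
    τ : Pid → ObsLabel

  forget : RichLabel → ObsLabel
  forget (rcom p v q _) = ocom p v q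
  forget (rsel p q l) = osel p q l
  forget (rcond p) = τ p
  forget (rcall _ p) = τ p

  data ProgStep : Program → State → ObsLabel → Program → State → Set where
    prog-step : ∀ {D C s ρ C' s'} → CStep D C s ρ C' s' →
                ProgStep (D , C) s (forget ρ) (D , C') s'

  noSelfI : Interaction → Set
  noSelfI (icom p _ q _) = p ≢ q
  noSelfI (isel p q _) = p ≢ q

  noSelf : Chor → Set
  noSelf (η at _ ⨾ C) = noSelfI η × noSelf C
  noSelf (cif _ _ C₁ C₂) = noSelf C₁ × noSelf C₂
  noSelf (call _) = ⊤
  noSelf (rtcall _ _ C) = noSelf C
  noSelf end = ⊤

  rtcallWF : DefSet → Chor → Set
  rtcallWF D (_ at _ ⨾ C) = rtcallWF D C
  rtcallWF D (cif _ _ C₁ C₂) = rtcallWF D C₁ × rtcallWF D C₂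
  rtcallWF D (call _) = ⊤
  rtcallWF D (rtcall X ps C) = ps ≢ [] × ps ⊆ Vars D X × rtcallWF D C
  rtcallWF D end = ⊤

  noRtcall : Chor → Set
  noRtcall (_ at _ ⨾ C) = noRtcall C
  noRtcall (cif _ _ C₁ C₂) = noRtcall C₁ × noRtcall C₂
  noRtcall (call _) = ⊤
  noRtcall (rtcall _ _ _) = Data.Empty.⊥
    where import Data.Empty
  noRtcall end = ⊤

  pn : DefSet → Chor → List Pid
  pn D (η at _ ⨾ C) = procsI η ++ pn D C
  pn D (cif p _ C₁ C₂) = p ∷ (pn D C₁ ++ pn D C₂)
  pn D (call X) = Vars D X
  pn D (rtcall _ ps C) = ps ++ pn D C
  pn D end = []

  WF : Program → Set
  WF (D , C) = noSelf C × rtcallWF D C ×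
    (∀ X → noSelf (Body D X) × noRtcall (Body D X) × Vars D X ≢ [] ×
           pn D (Body D X) ⊆ Vars D X)

  data Beh : Set where
    bend : Beh
    send : Pid → Expr → Ann → Beh → Beh
    recv : Pid → Var → Ann → Beh → Beh
    choose : Pid → Label → Ann → Beh → Beh
    branch : Pid → Maybe (Ann × Beh) → Maybe (Ann × Beh) → Beh
    bif : BExpr → Beh → Beh → Beh
    bcall : RecVar × Pid → Beh

  mutual
    data _⪰_ : Beh → Beh → Set where
      end⪰ : bend ⪰ bend
      call⪰ : ∀ {Y} → bcall Y ⪰ bcall Y
      send⪰ : ∀ {q e a B B'} → B ⪰ B' → send q e a B ⪰ send q e a B'
      recv⪰ : ∀ {q x a B B'} → B ⪰ B' → recv q x a B ⪰ recv q x a B'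
      choose⪰ : ∀ {q l a B B'} → B ⪰ B' → choose q l a B ⪰ choose q l a B'
      if⪰ : ∀ {b B₁ B₂ B₁' B₂'} → B₁ ⪰ B₁' → B₂ ⪰ B₂' → bif b B₁ B₂ ⪰ bif b B₁' B₂'
      branch⪰ : ∀ {q ml mr ml' mr'} → ml ⪰M ml' → mr ⪰M mr' →
                branch q ml mr ⪰ branch q ml' mr'

    data _⪰M_ : Maybe (Ann × Beh) → Maybe (Ann × Beh) → Set where
      none⪰ : ∀ {m} → m ⪰M nothing
      some⪰ : ∀ {a B B'} → B ⪰ B' → just (a , B) ⪰M just (a , B')

  -- Merge (as a relation): Merge B₁ B₂ B  means  B₁ ⊔ B₂ = B
  mutual
    data Merge : Beh → Beh → Beh → Set where
      m-end : Merge bend bend bend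
      m-call : ∀ {Y} → Merge (bcall Y) (bcall Y) (bcall Y)
      m-send : ∀ {q e a B₁ B₂ B} → Merge B₁ B₂ B →
               Merge (send q e a B₁) (send q e a B₂) (send q e a B)
      m-recv : ∀ {q x a B₁ B₂ B} → Merge B₁ B₂ B →
               Merge (recv q x a B₁) (recv q x a B₂) (recv q x a B)
      m-choose : ∀ {q l a B₁ B₂ B} → Merge B₁ B₂ B →
               Merge (choose q l a B₁) (choose q l a B₂) (choose q l a B)
      m-if : ∀ {b B₁ B₂ B₁' B₂' B₁'' B₂''} → Merge B₁ B₁' B₁'' → Merge B₂ B₂' B₂'' →
               Merge (bif b B₁ B₂) (bif b B₁' B₂') (bif b B₁'' B₂'')
      m-branch : ∀ {q ml mr ml' mr' ml'' mr''} → MergeM ml ml' ml'' → MergeM mr mr' mr'' →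
               Merge (branch q ml mr) (branch q ml' mr') (branch q ml'' mr'')

    data MergeM : Maybe (Ann × Beh) → Maybe (Ann × Beh) → Maybe (Ann × Beh) → Set where
      mm-nn : MergeM nothing nothing nothing
      mm-sn : ∀ {a B} → MergeM (just (a , B)) nothing (just (a , B))
      mm-ns : ∀ {a B} → MergeM nothing (just (a , B)) (just (a , B))
      mm-ss : ∀ {a B₁ B₂ B} → Merge B₁ B₂ B →
              MergeM (just (a , B₁)) (just (a , B₂)) (just (a , B))

  -- Projection [[D, C | r]] = B  (as a relation)
  data Proj (D : DefSet) : Chor → Pid → Beh → Set where
    pr-end : ∀ {r} → Proj D end r bend
    pr-com-snd : ∀ {p e q x a C B} → Proj D C p B →
                 Proj D (icom p e q x at a ⨾ C) p (send q e a B)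
    pr-com-rcv : ∀ {p e q x a C B} → q ≢ p → Proj D C q B →
                 Proj D (icom p e q x at a ⨾ C) q (recv p x a B)
    pr-com-oth : ∀ {p e q x a C r B} → r ≢ p → r ≢ q → Proj D C r B →
                 Proj D (icom p e q x at a ⨾ C) r B
    pr-sel-snd : ∀ {p q l a C B} → Proj D C p B →
                 Proj D (isel p q l at a ⨾ C) p (choose q l a B)
    pr-sel-left : ∀ {p q a C B} → q ≢ p → Proj D C q B →
                 Proj D (isel p q left at a ⨾ C) q (branch p (just (a , B)) nothing)
    pr-sel-right : ∀ {p q a C B} → q ≢ p → Proj D C q B →
                 Proj D (isel p q right at a ⨾ C) q (branch p nothing (just (a , B)))
    pr-sel-oth : ∀ {p q l a C r B} → r ≢ p → r ≢ q → Proj D C r B →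
                 Proj D (isel p q l at a ⨾ C) r B
    pr-if-own : ∀ {p b C₁ C₂ B₁ B₂} → Proj D C₁ p B₁ → Proj D C₂ p B₂ →
                 Proj D (cif p b C₁ C₂) p (bif b B₁ B₂)
    pr-if-oth : ∀ {p b C₁ C₂ r B₁ B₂ B} → r ≢ p → Proj D C₁ r B₁ → Proj D C₂ r B₂ →
                 Merge B₁ B₂ B → Proj D (cif p b C₁ C₂) r B
    pr-call-in : ∀ {X r} → r ∈ Vars D X → Proj D (call X) r (bcall (X , r))
    pr-call-out : ∀ {X r} → r ∉ Vars D X → Proj D (call X) r bend
    pr-rt-in : ∀ {X ps C r} → r ∈ ps → Proj D (rtcall X ps C) r (bcall (X , r))
    pr-rt-out : ∀ {X ps C r B} → r ∉ ps → Proj D C r B → Proj D (rtcall X ps C) r B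

  Projectable : DefSet → Chor → Pid → Set
  Projectable D C r = Σ Beh (Proj D C r)

  DefsProjectable : DefSet → Set
  DefsProjectable D = ∀ X r → r ∈ Vars D X → Projectable D (Body D X) r

  ProgProjectable : Program → Set
  ProgProjectable (D , C) = DefsProjectable D × (∀ r → r ∈ pn D C → Projectable D C r)

  sp : DefSet → Chor → Pid → Set
  sp D (_ at _ ⨾ C) r = sp D C r
  sp D (cif p b C₁ C₂) r = sp D C₁ r × sp D C₂ r × Projectable D (cif p b C₁ C₂) r
  sp D (call _) r = ⊤
  sp D (rtcall X ps C) r = sp D C r ×
    (∀ p → p ∈ ps → ∀ B B' → Proj D (Body D X) p B → Proj D C p B' → B ⪰ B')
  sp D end r = ⊤

  StronglyProjectable : Program → Set
  StronglyProjectable (D , C) = WF (D , C) × DefsProjectable D × (∀ r → sp D C r)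

  BDefs : Set
  BDefs = RecVar × Pid → Beh

  Network : Set
  Network = Pid → Beh

  ProcProgram : Set
  ProcProgram = BDefs × Network

  _≡N_ : Network → Network → Set
  N ≡N N' = ∀ p → N p ≡ N' p

  updN : Network → Pid → Beh → Network
  updN N p B r with r ≟Pid p
  ... | Relation.Nullary.yes _ = B
  ... | Relation.Nullary.no _ = N r

  _⪰N_ : Network → Network → Set
  N ⪰N N' = ∀ p → N p ⪰ N' p

  data PStep (Df : BDefs) : Network → State → RichLabel → Network → State → Set where
    p-com : ∀ {N N' s s' p q e x a a' B B' v} →
            N p ≡ send q e a B → N q ≡ recv p x a' B' → v ≡ eval e (s p) →
            N' ≡N updN (updN N p B) q B' → s' ≡S update s q x v →
            PStep Df N s (rcom p v q x) N' s'
    p-sel-left : ∀ {N N' s s' p q a a' B Bl mr} →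
            N p ≡ choose q left a B → N q ≡ branch p (just (a' , Bl)) mr →
            N' ≡N updN (updN N p B) q Bl → s ≡S s' →
            PStep Df N s (rsel p q left) N' s'
    p-sel-right : ∀ {N N' s s' p q a a' B Br ml} →
            N p ≡ choose q right a B → N q ≡ branch p ml (just (a' , Br)) →
            N' ≡N updN (updN N p B) q Br → s ≡S s' →
            PStep Df N s (rsel p q right) N' s'
    p-then : ∀ {N N' s s' p b B₁ B₂} →
            N p ≡ bif b B₁ B₂ → beval b (s p) ≡ true →
            N' ≡N updN N p B₁ → s ≡S s' → PStep Df N s (rcond p) N' s'
    p-else : ∀ {N N' s s' p b B₁ B₂} →
            N p ≡ bif b B₁ B₂ → beval b (s p) ≡ false →
            N' ≡N updN N p B₂ → s ≡S s' → PStep Df N s (rcond p) N' s'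
    p-call : ∀ {N N' s s' p X q} →
            N p ≡ bcall (X , q) → N' ≡N updN N p (Df (X , q)) → s ≡S s' →
            PStep Df N s (rcall X p) N' s'

  data PConfStep : ProcProgram → State → ObsLabel → ProcProgram → State → Set where
    pconf-step : ∀ {Df N s ρ N' s'} → PStep Df N s ρ N' s' →
                 PConfStep (Df , N) s (forget ρ) (Df , N') s'

  -- EPP (as a relation, since projection is a relation):
  -- IsEpp P (Df , N)  means  epp P = (Df , N).
  IsEpp : Program → ProcProgram → Set
  IsEpp (D , C) (Df , N) =
    (∀ X r → (r ∈ Vars D X → Proj D (Body D X) r (Df (X , r))) ×
             (r ∉ Vars D X → Df (X , r) ≡ bend)) ×
    (∀ r → (r ∈ pn D C → Proj D C r (N r)) × (r ∉ pn D C → N r ≡ bend))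

-- A choreography step is simulated process by process. A process not named in the step's label
-- keeps its projection; each named process performs its part of the label (send, receive,
-- select, branch, test a guard or enter a procedure), and the resulting local steps assemble
-- into one network step. The reduct is only reached up to ⪰: a step taken under a conditional
-- that a process does not test is performed by the merge of the two branch projections, which
-- can take that step because merge is a least upper bound for ⪰; and a process entering a
-- procedure that was already entered by others continues with the projection of the body,
-- which strong projectability places above the projection of the running continuation.
module Submission where

open import Defs
open import Data.Product using (Σ; _×_; _,_; proj₁; proj₂)
open import Relation.Binary.PropositionalEquality using (_≡_)

open import Data.Bool using (true; false)
open import Data.Empty using (⊥-elim)
open import Data.List using (List; []; _∷_; length)
open import Data.List.Membership.Propositional using (_∈_; _∉_)
open import Data.List.Membership.Propositional.Properties using (∈-++⁺ˡ; ∈-++⁺ʳ; ∈-filter⁺; ∈-filter⁻)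
open import Data.List.Relation.Binary.Subset.Propositional using (_⊆_)
open import Data.List.Relation.Unary.All using ([]; _∷_)
open import Data.List.Relation.Unary.All.Properties using (All¬⇒¬Any)
open import Data.List.Relation.Unary.Any using (here; there)
open import Data.Maybe using (just; nothing)
open import Data.Sum using (_⊎_; inj₁; inj₂)
open import Data.Unit using (⊤)
open import Function using (_∘_)
open import Relation.Binary.PropositionalEquality using (refl; sym; trans; subst; _≢_)
open import Relation.Nullary using (yes; no; ¬?)

module Completeness (σ : Sig) where
  open Theory σ
  open import Data.List.Membership.DecPropositional _≟Pid_ using (_∈?_)

  mutual
    ⪰-refl : ∀ B → B ⪰ B
    ⪰-refl bend = end⪰
    ⪰-refl (send q e a B) = send⪰ (⪰-refl B)
    ⪰-refl (recv q x a B) = recv⪰ (⪰-refl B)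
    ⪰-refl (choose q l a B) = choose⪰ (⪰-refl B)
    ⪰-refl (branch q ml mr) = branch⪰ (⪰M-refl ml) (⪰M-refl mr)
    ⪰-refl (bif b B₁ B₂) = if⪰ (⪰-refl B₁) (⪰-refl B₂)
    ⪰-refl (bcall Y) = call⪰

    ⪰M-refl : ∀ m → m ⪰M m
    ⪰M-refl nothing = none⪰
    ⪰M-refl (just (a , B)) = some⪰ (⪰-refl B)

  mutual
    ⪰-trans : ∀ {A B C} → A ⪰ B → B ⪰ C → A ⪰ C
    ⪰-trans end⪰ end⪰ = end⪰
    ⪰-trans call⪰ call⪰ = call⪰
    ⪰-trans (send⪰ h) (send⪰ k) = send⪰ (⪰-trans h k)
    ⪰-trans (recv⪰ h) (recv⪰ k) = recv⪰ (⪰-trans h k)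
    ⪰-trans (choose⪰ h) (choose⪰ k) = choose⪰ (⪰-trans h k)
    ⪰-trans (if⪰ h₁ h₂) (if⪰ k₁ k₂) = if⪰ (⪰-trans h₁ k₁) (⪰-trans h₂ k₂)
    ⪰-trans (branch⪰ hl hr) (branch⪰ kl kr) = branch⪰ (⪰M-trans hl kl) (⪰M-trans hr kr)

    ⪰M-trans : ∀ {A B C} → A ⪰M B → B ⪰M C → A ⪰M C
    ⪰M-trans h none⪰ = none⪰
    ⪰M-trans (some⪰ h) (some⪰ k) = some⪰ (⪰-trans h k)

  mutual
    merge-upperBound : ∀ {B₁ B₂ B} → Merge B₁ B₂ B → B ⪰ B₁ × B ⪰ B₂
    merge-upperBound m-end = end⪰ , end⪰
    merge-upperBound m-call = call⪰ , call⪰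
    merge-upperBound (m-send m) = let h₁ , h₂ = merge-upperBound m in send⪰ h₁ , send⪰ h₂
    merge-upperBound (m-recv m) = let h₁ , h₂ = merge-upperBound m in recv⪰ h₁ , recv⪰ h₂
    merge-upperBound (m-choose m) = let h₁ , h₂ = merge-upperBound m in choose⪰ h₁ , choose⪰ h₂
    merge-upperBound (m-if m m') =
      let h₁ , h₂ = merge-upperBound m ; h₁' , h₂' = merge-upperBound m' in if⪰ h₁ h₁' , if⪰ h₂ h₂'
    merge-upperBound (m-branch ml mr) =
      let hl₁ , hl₂ = mergeM-upperBound ml ; hr₁ , hr₂ = mergeM-upperBound mr
      in branch⪰ hl₁ hr₁ , branch⪰ hl₂ hr₂

    mergeM-upperBound : ∀ {m₁ m₂ m} → MergeM m₁ m₂ m → m ⪰M m₁ × m ⪰M m₂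
    mergeM-upperBound mm-nn = none⪰ , none⪰
    mergeM-upperBound (mm-sn {B = B}) = some⪰ (⪰-refl B) , none⪰
    mergeM-upperBound (mm-ns {B = B}) = none⪰ , some⪰ (⪰-refl B)
    mergeM-upperBound (mm-ss m) = let h₁ , h₂ = merge-upperBound m in some⪰ h₁ , some⪰ h₂

  mutual
    merge-least : ∀ {B₁ B₂ B A} → Merge B₁ B₂ B → A ⪰ B₁ → A ⪰ B₂ → A ⪰ B
    merge-least m-end h k = h
    merge-least m-call h k = h
    merge-least (m-send m) (send⪰ h) (send⪰ k) = send⪰ (merge-least m h k)
    merge-least (m-recv m) (recv⪰ h) (recv⪰ k) = recv⪰ (merge-least m h k)
    merge-least (m-choose m) (choose⪰ h) (choose⪰ k) = choose⪰ (merge-least m h k)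
    merge-least (m-if m m') (if⪰ h h') (if⪰ k k') = if⪰ (merge-least m h k) (merge-least m' h' k')
    merge-least (m-branch ml mr) (branch⪰ hl hr) (branch⪰ kl kr) =
      branch⪰ (mergeM-least ml hl kl) (mergeM-least mr hr kr)

    mergeM-least : ∀ {m₁ m₂ m n} → MergeM m₁ m₂ m → n ⪰M m₁ → n ⪰M m₂ → n ⪰M m
    mergeM-least mm-nn h k = none⪰
    mergeM-least mm-sn h k = h
    mergeM-least mm-ns h k = k
    mergeM-least (mm-ss m) (some⪰ h) (some⪰ k) = some⪰ (merge-least m h k)

  module _ (D : DefSet) where

    proj-prefix-mono : ∀ {η a C₀ C₀' r B B'} →
      (∀ {B₀ B₀'} → Proj D C₀ r B₀ → Proj D C₀' r B₀' → B₀ ⪰ B₀') →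
      Proj D (η at a ⨾ C₀) r B → Proj D (η at a ⨾ C₀') r B' → B ⪰ B'
    proj-prefix-mono f (pr-com-snd p) (pr-com-snd p') = send⪰ (f p p')
    proj-prefix-mono f (pr-com-snd p) (pr-com-rcv q≢p p') = ⊥-elim (q≢p refl)
    proj-prefix-mono f (pr-com-snd p) (pr-com-oth r≢p _ p') = ⊥-elim (r≢p refl)
    proj-prefix-mono f (pr-com-rcv q≢p p) (pr-com-snd p') = ⊥-elim (q≢p refl)
    proj-prefix-mono f (pr-com-rcv _ p) (pr-com-rcv _ p') = recv⪰ (f p p')
    proj-prefix-mono f (pr-com-rcv _ p) (pr-com-oth _ r≢q p') = ⊥-elim (r≢q refl)
    proj-prefix-mono f (pr-com-oth r≢p _ p) (pr-com-snd p') = ⊥-elim (r≢p refl)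
    proj-prefix-mono f (pr-com-oth _ r≢q p) (pr-com-rcv _ p') = ⊥-elim (r≢q refl)
    proj-prefix-mono f (pr-com-oth _ _ p) (pr-com-oth _ _ p') = f p p'
    proj-prefix-mono f (pr-sel-snd p) (pr-sel-snd p') = choose⪰ (f p p')
    proj-prefix-mono f (pr-sel-snd p) (pr-sel-left q≢p p') = ⊥-elim (q≢p refl)
    proj-prefix-mono f (pr-sel-snd p) (pr-sel-right q≢p p') = ⊥-elim (q≢p refl)
    proj-prefix-mono f (pr-sel-snd p) (pr-sel-oth r≢p _ p') = ⊥-elim (r≢p refl)
    proj-prefix-mono f (pr-sel-left q≢p p) (pr-sel-snd p') = ⊥-elim (q≢p refl)
    proj-prefix-mono f (pr-sel-left _ p) (pr-sel-left _ p') = branch⪰ (some⪰ (f p p')) none⪰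
    proj-prefix-mono f (pr-sel-left _ p) (pr-sel-oth _ r≢q p') = ⊥-elim (r≢q refl)
    proj-prefix-mono f (pr-sel-right q≢p p) (pr-sel-snd p') = ⊥-elim (q≢p refl)
    proj-prefix-mono f (pr-sel-right _ p) (pr-sel-right _ p') = branch⪰ none⪰ (some⪰ (f p p'))
    proj-prefix-mono f (pr-sel-right _ p) (pr-sel-oth _ r≢q p') = ⊥-elim (r≢q refl)
    proj-prefix-mono f (pr-sel-oth r≢p _ p) (pr-sel-snd p') = ⊥-elim (r≢p refl)
    proj-prefix-mono f (pr-sel-oth _ r≢q p) (pr-sel-left _ p') = ⊥-elim (r≢q refl)
    proj-prefix-mono f (pr-sel-oth _ r≢q p) (pr-sel-right _ p') = ⊥-elim (r≢q refl)
    proj-prefix-mono f (pr-sel-oth _ _ p) (pr-sel-oth _ _ p') = f p p'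

    -- Projection is even a partial function, but this weaker form suffices and spares proving
    -- that merge is one.
    proj-⪰ : ∀ C {r B B'} → Proj D C r B → Proj D C r B' → B ⪰ B'
    proj-⪰ (η at a ⨾ C) p p' = proj-prefix-mono (proj-⪰ C) p p'
    proj-⪰ (cif _ _ C₁ C₂) (pr-if-own p₁ p₂) (pr-if-own p₁' p₂') =
      if⪰ (proj-⪰ C₁ p₁ p₁') (proj-⪰ C₂ p₂ p₂')
    proj-⪰ (cif _ _ _ _) (pr-if-own _ _) (pr-if-oth r≢p _ _ _) = ⊥-elim (r≢p refl)
    proj-⪰ (cif _ _ _ _) (pr-if-oth r≢p _ _ _) (pr-if-own _ _) = ⊥-elim (r≢p refl)
    proj-⪰ (cif _ _ C₁ C₂) (pr-if-oth _ p₁ p₂ m) (pr-if-oth _ p₁' p₂' m') =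
      let B⪰B₁ , B⪰B₂ = merge-upperBound m
      in merge-least m' (⪰-trans B⪰B₁ (proj-⪰ C₁ p₁ p₁')) (⪰-trans B⪰B₂ (proj-⪰ C₂ p₂ p₂'))
    proj-⪰ (call X) (pr-call-in _) (pr-call-in _) = call⪰
    proj-⪰ (call X) (pr-call-in r∈) (pr-call-out r∉) = ⊥-elim (r∉ r∈)
    proj-⪰ (call X) (pr-call-out r∉) (pr-call-in r∈) = ⊥-elim (r∉ r∈)
    proj-⪰ (call X) (pr-call-out _) (pr-call-out _) = end⪰
    proj-⪰ (rtcall X ps C) (pr-rt-in _) (pr-rt-in _) = call⪰
    proj-⪰ (rtcall X ps C) (pr-rt-in r∈) (pr-rt-out r∉ _) = ⊥-elim (r∉ r∈)
    proj-⪰ (rtcall X ps C) (pr-rt-out r∉ _) (pr-rt-in r∈) = ⊥-elim (r∉ r∈)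
    proj-⪰ (rtcall X ps C) (pr-rt-out _ p) (pr-rt-out _ p') = proj-⪰ C p p'
    proj-⪰ end pr-end pr-end = end⪰

    proj-absent : ∀ C {r} → r ∉ pn D C → Proj D C r bend
    proj-absent (icom p e q x at a ⨾ C) r∉ =
      pr-com-oth (r∉ ∘ here) (r∉ ∘ there ∘ here) (proj-absent C (r∉ ∘ there ∘ there))
    proj-absent (isel p q l at a ⨾ C) r∉ =
      pr-sel-oth (r∉ ∘ here) (r∉ ∘ there ∘ here) (proj-absent C (r∉ ∘ there ∘ there))
    proj-absent (cif p b C₁ C₂) r∉ =
      pr-if-oth (r∉ ∘ here) (proj-absent C₁ (r∉ ∘ there ∘ ∈-++⁺ˡ))
                (proj-absent C₂ (r∉ ∘ there ∘ ∈-++⁺ʳ (pn D C₁))) m-end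
    proj-absent (call X) r∉ = pr-call-out r∉
    proj-absent (rtcall X ps C) r∉ = pr-rt-out (r∉ ∘ ∈-++⁺ˡ) (proj-absent C (r∉ ∘ ∈-++⁺ʳ ps))
    proj-absent end r∉ = pr-end

    proj-prefix-idle : ∀ {η a C r B} → r ∉ procsI η → Proj D (η at a ⨾ C) r B → Proj D C r B
    proj-prefix-idle r∉ (pr-com-snd _) = ⊥-elim (r∉ (here refl))
    proj-prefix-idle r∉ (pr-com-rcv _ _) = ⊥-elim (r∉ (there (here refl)))
    proj-prefix-idle r∉ (pr-com-oth _ _ p) = p
    proj-prefix-idle r∉ (pr-sel-snd _) = ⊥-elim (r∉ (here refl))
    proj-prefix-idle r∉ (pr-sel-left _ _) = ⊥-elim (r∉ (there (here refl)))
    proj-prefix-idle r∉ (pr-sel-right _ _) = ⊥-elim (r∉ (there (here refl)))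
    proj-prefix-idle r∉ (pr-sel-oth _ _ p) = p

    proj-rtcall-idle : ∀ {X ps C r B} → r ∉ ps → Proj D (rtcall X ps C) r B → Proj D C r B
    proj-rtcall-idle r∉ (pr-rt-in r∈) = ⊥-elim (r∉ r∈)
    proj-rtcall-idle r∉ (pr-rt-out _ p) = p

    proj-epp : ∀ C (N : Network) →
      (∀ r → (r ∈ pn D C → Proj D C r (N r)) × (r ∉ pn D C → N r ≡ bend)) →
      ∀ r → Proj D C r (N r)
    proj-epp C N epp r with r ∈? pn D C
    ... | yes r∈ = proj₁ (epp r) r∈
    ... | no r∉ = subst (Proj D C r) (sym (proj₂ (epp r) r∉)) (proj-absent C r∉)

  ∉-remove : ∀ {p ps} → p ∉ remove p ps
  ∉-remove {p} {ps} p∈ = proj₂ (∈-filter⁻ (λ q → ¬? (q ≟Pid p)) {xs = ps} p∈) refl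

  ∈-remove⁻ : ∀ {p r ps} → r ∈ remove p ps → r ∈ ps
  ∈-remove⁻ {p} {ps = ps} r∈ = proj₁ (∈-filter⁻ (λ q → ¬? (q ≟Pid p)) {xs = ps} r∈)

  ∈-remove⁺ : ∀ {p r ps} → r ∈ ps → r ≢ p → r ∈ remove p ps
  ∈-remove⁺ {p} = ∈-filter⁺ (λ q → ¬? (q ≟Pid p))

  ∉-singleton : ∀ {r p} {xs : List Pid} → r ∉ xs → p ∈ xs → r ∉ p ∷ []
  ∉-singleton r∉ p∈ = All¬⇒¬Any ((λ { refl → r∉ p∈ }) ∷ [])

  length≡1⇒∈-unique : ∀ {xs : List Pid} {p r} → length xs ≡ 1 → p ∈ xs → r ∈ xs → r ≡ p
  length≡1⇒∈-unique {_ ∷ []} _ (here refl) (here refl) = refl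

  data Acts (Df : BDefs) (s : State) : Pid → RichLabel → Beh → Beh → Set where
    acts-send : ∀ {r v q x e a B} → v ≡ eval e (s r) → Acts Df s r (rcom r v q x) (send q e a B) B
    acts-recv : ∀ {r p v x a B} → r ≢ p → Acts Df s r (rcom p v r x) (recv p x a B) B
    acts-choose : ∀ {r q l a B} → Acts Df s r (rsel r q l) (choose q l a B) B
    acts-left : ∀ {r p a B mr} → r ≢ p → Acts Df s r (rsel p r left) (branch p (just (a , B)) mr) B
    acts-right : ∀ {r p a B ml} → r ≢ p → Acts Df s r (rsel p r right) (branch p ml (just (a , B))) B
    acts-then : ∀ {r b B₁ B₂} → beval b (s r) ≡ true → Acts Df s r (rcond r) (bif b B₁ B₂) B₁
    acts-else : ∀ {r b B₁ B₂} → beval b (s r) ≡ false → Acts Df s r (rcond r) (bif b B₁ B₂) B₂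
    acts-call : ∀ {r X} → Acts Df s r (rcall X r) (bcall (X , r)) (Df (X , r))

  data LocalStep (Df : BDefs) (s : State) (r : Pid) (ρ : RichLabel) : Beh → Beh → Set where
    idle : ∀ {B} → r ∉ procsR ρ → LocalStep Df s r ρ B B
    acts : ∀ {B B°} → Acts Df s r ρ B B° → LocalStep Df s r ρ B B°

  module _ {Df : BDefs} {s : State} where

    acts-involved : ∀ {r ρ B B°} → Acts Df s r ρ B B° → r ∈ procsR ρ
    acts-involved (acts-send _) = here refl
    acts-involved (acts-recv _) = there (here refl)
    acts-involved acts-choose = here refl
    acts-involved (acts-left _) = there (here refl)
    acts-involved (acts-right _) = there (here refl)
    acts-involved (acts-then _) = here refl
    acts-involved (acts-else _) = here refl
    acts-involved acts-call = here refl

    localStep-idle : ∀ {r ρ B B°} → r ∉ procsR ρ → LocalStep Df s r ρ B B° → B ≡ B°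
    localStep-idle _ (idle _) = refl
    localStep-idle r∉ (acts a) = ⊥-elim (r∉ (acts-involved a))

    localStep-acts : ∀ {r ρ B B°} → r ∈ procsR ρ → LocalStep Df s r ρ B B° → Acts Df s r ρ B B°
    localStep-acts r∈ (idle r∉) = ⊥-elim (r∉ r∈)
    localStep-acts _ (acts a) = a

    acts-merge : ∀ {r ρ B₁ B₂ B B₁° B₂°} → Merge B₁ B₂ B →
      Acts Df s r ρ B₁ B₁° → Acts Df s r ρ B₂ B₂° →
      Σ Beh λ B° → Acts Df s r ρ B B° × B° ⪰ B₁° × B° ⪰ B₂°
    acts-merge (m-send m) (acts-send ve) (acts-send _) = _ , acts-send ve , merge-upperBound m
    acts-merge (m-recv m) (acts-recv r≢p) (acts-recv _) = _ , acts-recv r≢p , merge-upperBound m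
    acts-merge (m-choose m) acts-choose acts-choose = _ , acts-choose , merge-upperBound m
    acts-merge (m-branch (mm-ss m) _) (acts-left r≢p) (acts-left _) = _ , acts-left r≢p , merge-upperBound m
    acts-merge (m-branch _ (mm-ss m)) (acts-right r≢p) (acts-right _) = _ , acts-right r≢p , merge-upperBound m
    acts-merge (m-if m _) (acts-then bt) (acts-then _) = _ , acts-then bt , merge-upperBound m
    acts-merge (m-if _ m) (acts-else bf) (acts-else _) = _ , acts-else bf , merge-upperBound m
    acts-merge (m-if _ _) (acts-then bt) (acts-else bf) with trans (sym bt) bf
    ... | ()
    acts-merge (m-if _ _) (acts-else bf) (acts-then bt) with trans (sym bt) bf
    ... | ()
    acts-merge m-call acts-call acts-call = _ , acts-call , ⪰-refl _ , ⪰-refl _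

    localStep-merge : ∀ {r ρ B₁ B₂ B B₁° B₂°} → Merge B₁ B₂ B →
      LocalStep Df s r ρ B₁ B₁° → LocalStep Df s r ρ B₂ B₂° →
      Σ Beh λ B° → LocalStep Df s r ρ B B° × B° ⪰ B₁° × B° ⪰ B₂°
    localStep-merge m (idle r∉) (idle _) = _ , idle r∉ , merge-upperBound m
    localStep-merge m (idle r∉) (acts a) = ⊥-elim (r∉ (acts-involved a))
    localStep-merge m (acts a) (idle r∉) = ⊥-elim (r∉ (acts-involved a))
    localStep-merge m (acts a₁) (acts a₂) = let B° , a , h = acts-merge m a₁ a₂ in B° , acts a , h

    acts-send⁻ : ∀ {p v q x B B°} → Acts Df s p (rcom p v q x) B B° →
      Σ Expr λ e → Σ Ann λ a → B ≡ send q e a B° × v ≡ eval e (s p)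
    acts-send⁻ (acts-send ve) = _ , _ , refl , ve
    acts-send⁻ (acts-recv p≢p) = ⊥-elim (p≢p refl)

    acts-recv⁻ : ∀ {p v q x B B°} → p ≢ q → Acts Df s q (rcom p v q x) B B° →
      Σ Ann λ a → B ≡ recv p x a B°
    acts-recv⁻ p≢q (acts-send _) = ⊥-elim (p≢q refl)
    acts-recv⁻ _ (acts-recv _) = _ , refl

    acts-choose⁻ : ∀ {p q l B B°} → Acts Df s p (rsel p q l) B B° → Σ Ann λ a → B ≡ choose q l a B°
    acts-choose⁻ acts-choose = _ , refl
    acts-choose⁻ (acts-left p≢p) = ⊥-elim (p≢p refl)
    acts-choose⁻ (acts-right p≢p) = ⊥-elim (p≢p refl)

    acts-left⁻ : ∀ {p q B B°} → p ≢ q → Acts Df s q (rsel p q left) B B° →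
      Σ Ann λ a → Σ _ λ mr → B ≡ branch p (just (a , B°)) mr
    acts-left⁻ p≢q acts-choose = ⊥-elim (p≢q refl)
    acts-left⁻ _ (acts-left _) = _ , _ , refl

    acts-right⁻ : ∀ {p q B B°} → p ≢ q → Acts Df s q (rsel p q right) B B° →
      Σ Ann λ a → Σ _ λ ml → B ≡ branch p ml (just (a , B°))
    acts-right⁻ p≢q acts-choose = ⊥-elim (p≢q refl)
    acts-right⁻ _ (acts-right _) = _ , _ , refl

    acts-cond⁻ : ∀ {p B B°} → Acts Df s p (rcond p) B B° →
      Σ BExpr λ b → Σ Beh λ B₁ → Σ Beh λ B₂ → B ≡ bif b B₁ B₂ ×
        ((beval b (s p) ≡ true × B° ≡ B₁) ⊎ (beval b (s p) ≡ false × B° ≡ B₂))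
    acts-cond⁻ (acts-then bt) = _ , _ , _ , refl , inj₁ (bt , refl)
    acts-cond⁻ (acts-else bf) = _ , _ , _ , refl , inj₂ (bf , refl)

    acts-call⁻ : ∀ {p X B B°} → Acts Df s p (rcall X p) B B° → B ≡ bcall (X , p) × B° ≡ Df (X , p)
    acts-call⁻ acts-call = refl , refl

  updN-≡N : ∀ {N N° : Network} {p B} → N° p ≡ B → (∀ r → r ∉ p ∷ [] → N° r ≡ N r) →
    N° ≡N updN N p B
  updN-≡N {p = p} N°p≡ unchanged r with r ≟Pid p
  ... | yes refl = N°p≡
  ... | no r≢p = unchanged r (All¬⇒¬Any (r≢p ∷ []))

  updN²-≡N : ∀ {N N° : Network} {p q B B'} → N° p ≡ B → N° q ≡ B' →
    (∀ r → r ∉ p ∷ q ∷ [] → N° r ≡ N r) → N° ≡N updN (updN N p B) q B'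
  updN²-≡N {p = p} {q} N°p≡ N°q≡ unchanged r with r ≟Pid q
  ... | yes refl = N°q≡
  ... | no r≢q with r ≟Pid p
  ...   | yes refl = N°p≡
  ...   | no r≢p = unchanged r (All¬⇒¬Any (r≢p ∷ r≢q ∷ []))

  SelfFree : RichLabel → Set
  SelfFree (rcom p _ q _) = p ≢ q
  SelfFree (rsel p q _) = p ≢ q
  SelfFree (rcond _) = ⊤
  SelfFree (rcall _ _) = ⊤

  StateEffect : RichLabel → State → State → Set
  StateEffect (rcom _ v q x) s s' = s' ≡S update s q x v
  StateEffect (rsel _ _ _) s s' = s ≡S s'
  StateEffect (rcond _) s s' = s ≡S s'
  StateEffect (rcall _ _) s s' = s ≡S s'

  module _ {D : DefSet} where

    cstep-selfFree : ∀ {C s ρ C' s'} → CStep D C s ρ C' s' → noSelf C → SelfFree ρ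
    cstep-selfFree (s-com _ _) (p≢q , _) = p≢q
    cstep-selfFree (s-sel _) (p≢q , _) = p≢q
    cstep-selfFree (s-then _ _) _ = _
    cstep-selfFree (s-else _ _) _ = _
    cstep-selfFree (s-delay st _) (_ , ns) = cstep-selfFree st ns
    cstep-selfFree (s-delay-if _ st _) (ns , _) = cstep-selfFree st ns
    cstep-selfFree (s-delay-rt _ st) ns = cstep-selfFree st ns
    cstep-selfFree (s-call-one _ _ _) _ = _
    cstep-selfFree (s-call-many _ _ _) _ = _
    cstep-selfFree (s-rt-many _ _ _) _ = _
    cstep-selfFree (s-rt-one _ _ _) _ = _

    cstep-stateEffect : ∀ {C s ρ C' s'} → CStep D C s ρ C' s' → StateEffect ρ s s'
    cstep-stateEffect (s-com _ eff) = eff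
    cstep-stateEffect (s-sel eff) = eff
    cstep-stateEffect (s-then _ eff) = eff
    cstep-stateEffect (s-else _ eff) = eff
    cstep-stateEffect (s-delay st _) = cstep-stateEffect st
    cstep-stateEffect (s-delay-if _ st _) = cstep-stateEffect st
    cstep-stateEffect (s-delay-rt _ st) = cstep-stateEffect st
    cstep-stateEffect (s-call-one eff _ _) = eff
    cstep-stateEffect (s-call-many eff _ _) = eff
    cstep-stateEffect (s-rt-many eff _ _) = eff
    cstep-stateEffect (s-rt-one eff _ _) = eff

  module _ {Df : BDefs} {s : State} where

    localSteps-unchanged : ∀ {ρ} {N N° : Network} → (∀ r → LocalStep Df s r ρ (N r) (N° r)) →
      ∀ r → r ∉ procsR ρ → N° r ≡ N r
    localSteps-unchanged steps r r∉ = sym (localStep-idle r∉ (steps r))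

    localSteps⇒pstep : ∀ ρ {N N° : Network} {s'} → SelfFree ρ → StateEffect ρ s s' →
      (∀ r → LocalStep Df s r ρ (N r) (N° r)) → PStep Df N s ρ N° s'
    localSteps⇒pstep (rcom p v q x) p≢q eff steps
      with acts-send⁻ (localStep-acts (here refl) (steps p))
         | acts-recv⁻ p≢q (localStep-acts (there (here refl)) (steps q))
    ... | _ , _ , Np≡ , v≡ | _ , Nq≡ = p-com Np≡ Nq≡ v≡ (updN²-≡N refl refl (localSteps-unchanged steps)) eff
    localSteps⇒pstep (rsel p q left) p≢q eff steps
      with acts-choose⁻ (localStep-acts (here refl) (steps p))
         | acts-left⁻ p≢q (localStep-acts (there (here refl)) (steps q))
    ... | _ , Np≡ | _ , _ , Nq≡ = p-sel-left Np≡ Nq≡ (updN²-≡N refl refl (localSteps-unchanged steps)) eff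
    localSteps⇒pstep (rsel p q right) p≢q eff steps
      with acts-choose⁻ (localStep-acts (here refl) (steps p))
         | acts-right⁻ p≢q (localStep-acts (there (here refl)) (steps q))
    ... | _ , Np≡ | _ , _ , Nq≡ = p-sel-right Np≡ Nq≡ (updN²-≡N refl refl (localSteps-unchanged steps)) eff
    localSteps⇒pstep (rcond p) _ eff steps with acts-cond⁻ (localStep-acts (here refl) (steps p))
    ... | _ , _ , _ , Np≡ , inj₁ (bt , N°p≡) = p-then Np≡ bt (updN-≡N N°p≡ (localSteps-unchanged steps)) eff
    ... | _ , _ , _ , Np≡ , inj₂ (bf , N°p≡) = p-else Np≡ bf (updN-≡N N°p≡ (localSteps-unchanged steps)) eff
    localSteps⇒pstep (rcall X p) _ eff steps with acts-call⁻ (localStep-acts (here refl) (steps p))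
    ... | Np≡ , N°p≡ = p-call Np≡ (updN-≡N N°p≡ (localSteps-unchanged steps)) eff

  module Simulation (D : DefSet) (Df : BDefs)
    (epp-defs : ∀ X r → r ∈ Vars D X → Proj D (Body D X) r (Df (X , r)))
    (pn-body : ∀ X → pn D (Body D X) ⊆ Vars D X) where

    LocalSimulation : State → RichLabel → Chor → Pid → Beh → Set
    LocalSimulation s ρ C' r B =
      Σ Beh λ B° → LocalStep Df s r ρ B B° × (∀ {B'} → Proj D C' r B' → B° ⪰ B')

    localSimulation-merge : ∀ {s ρ p b C₁' C₂' r B₁ B₂ B} → r ≢ p → Merge B₁ B₂ B →
      LocalSimulation s ρ C₁' r B₁ → LocalSimulation s ρ C₂' r B₂ →
      LocalSimulation s ρ (cif p b C₁' C₂') r B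
    localSimulation-merge r≢p m (_ , L₁ , H₁) (_ , L₂ , H₂) =
      let B° , L , B°⪰B₁° , B°⪰B₂° = localStep-merge m L₁ L₂
      in B° , L , λ where
           (pr-if-own _ _) → ⊥-elim (r≢p refl)
           (pr-if-oth _ q₁ q₂ m') → merge-least m' (⪰-trans B°⪰B₁° (H₁ q₁)) (⪰-trans B°⪰B₂° (H₂ q₂))

    simulate-call : ∀ {X s ρ C' s' r B} → CStep D (call X) s ρ C' s' → Proj D (call X) r B →
      LocalSimulation s ρ C' r B
    simulate-call {X} (s-call-one _ p∈ len) (pr-call-in r∈) with length≡1⇒∈-unique len p∈ r∈
    ... | refl = _ , acts acts-call , proj-⪰ D _ (epp-defs X _ r∈)
    simulate-call {X} (s-call-one _ p∈ _) (pr-call-out r∉) =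
      _ , idle (∉-singleton r∉ p∈) , proj-⪰ D _ (proj-absent D _ (r∉ ∘ pn-body X))
    simulate-call {X} {r = r} (s-call-many {p = p} _ _ _) (pr-call-in r∈) with r ≟Pid p
    ... | yes refl = _ , acts acts-call ,
                     proj-⪰ D _ (epp-defs X r r∈) ∘ proj-rtcall-idle D (∉-remove {ps = Vars D X})
    ... | no r≢p = _ , idle (All¬⇒¬Any (r≢p ∷ [])) , proj-⪰ D _ (pr-rt-in (∈-remove⁺ r∈ r≢p))
    simulate-call {X} (s-call-many _ p∈ _) (pr-call-out r∉) =
      _ , idle (∉-singleton r∉ p∈) ,
      proj-⪰ D _ (pr-rt-out (r∉ ∘ ∈-remove⁻) (proj-absent D _ (r∉ ∘ pn-body X)))

    simulate-rt-many : ∀ {X ps C s p r B} → ps ⊆ Vars D X → sp D (rtcall X ps C) r → p ∈ ps →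
      Proj D (rtcall X ps C) r B → LocalSimulation s (rcall X p) (rtcall X (remove p ps) C) r B
    simulate-rt-many {X} {ps} {p = p} {r} ps⊆ (_ , body⪰) _ (pr-rt-in r∈) with r ≟Pid p
    ... | yes refl = _ , acts acts-call ,
                     body⪰ r r∈ _ _ (epp-defs X r (ps⊆ r∈)) ∘ proj-rtcall-idle D (∉-remove {ps = ps})
    ... | no r≢p = _ , idle (All¬⇒¬Any (r≢p ∷ [])) , proj-⪰ D _ (pr-rt-in (∈-remove⁺ r∈ r≢p))
    simulate-rt-many _ _ p∈ (pr-rt-out r∉ q) =
      _ , idle (∉-singleton r∉ p∈) , proj-⪰ D _ (pr-rt-out (r∉ ∘ ∈-remove⁻) q)

    simulate-rt-one : ∀ {X ps C s p r B} → ps ⊆ Vars D X → sp D (rtcall X ps C) r → p ∈ ps →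
      length ps ≡ 1 → Proj D (rtcall X ps C) r B → LocalSimulation s (rcall X p) C r B
    simulate-rt-one {X} ps⊆ (_ , body⪰) p∈ len (pr-rt-in r∈) with length≡1⇒∈-unique len p∈ r∈
    ... | refl = _ , acts acts-call , body⪰ _ r∈ _ _ (epp-defs X _ (ps⊆ r∈))
    simulate-rt-one _ _ p∈ _ (pr-rt-out r∉ q) =
      _ , idle (∉-singleton r∉ p∈) , proj-⪰ D _ q

    mutual
      simulate : ∀ {C s ρ C' s' r B} → CStep D C s ρ C' s' → rtcallWF D C → sp D C r →
        Proj D C r B → LocalSimulation s ρ C' r B
      simulate (s-com ve _) _ _ (pr-com-snd q) = _ , acts (acts-send ve) , proj-⪰ D _ q
      simulate (s-com _ _) _ _ (pr-com-rcv r≢p q) = _ , acts (acts-recv r≢p) , proj-⪰ D _ q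
      simulate (s-com _ _) _ _ (pr-com-oth r≢p r≢q q) =
        _ , idle (All¬⇒¬Any (r≢p ∷ r≢q ∷ [])) , proj-⪰ D _ q
      simulate (s-sel _) _ _ (pr-sel-snd q) = _ , acts acts-choose , proj-⪰ D _ q
      simulate (s-sel _) _ _ (pr-sel-left r≢p q) = _ , acts (acts-left r≢p) , proj-⪰ D _ q
      simulate (s-sel _) _ _ (pr-sel-right r≢p q) = _ , acts (acts-right r≢p) , proj-⪰ D _ q
      simulate (s-sel _) _ _ (pr-sel-oth r≢p r≢q q) =
        _ , idle (All¬⇒¬Any (r≢p ∷ r≢q ∷ [])) , proj-⪰ D _ q
      simulate (s-then bt _) _ _ (pr-if-own q₁ _) = _ , acts (acts-then bt) , proj-⪰ D _ q₁
      simulate (s-then _ _) _ _ (pr-if-oth r≢p q₁ _ m) =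
        _ , idle (All¬⇒¬Any (r≢p ∷ [])) , ⪰-trans (proj₁ (merge-upperBound m)) ∘ proj-⪰ D _ q₁
      simulate (s-else bf _) _ _ (pr-if-own _ q₂) = _ , acts (acts-else bf) , proj-⪰ D _ q₂
      simulate (s-else _ _) _ _ (pr-if-oth r≢p _ q₂ m) =
        _ , idle (All¬⇒¬Any (r≢p ∷ [])) , ⪰-trans (proj₂ (merge-upperBound m)) ∘ proj-⪰ D _ q₂
      simulate {r = r} (s-delay {ρ = ρ} st η⊥ρ) w spC q with r ∈? procsR ρ
      ... | no r∉ρ = _ , idle r∉ρ , proj-prefix-mono D (simulate-idle st w spC r∉ρ) q
      ... | yes r∈ρ =
        let r∉η = λ r∈η → η⊥ρ r r∈η r∈ρ
            B° , L , H = simulate st w spC (proj-prefix-idle D r∉η q)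
        in B° , L , H ∘ proj-prefix-idle D r∉η
      simulate (s-delay-if p∉ρ st₁ st₂) (w₁ , w₂) (sp₁ , sp₂ , _) (pr-if-own q₁ q₂) =
        _ , idle p∉ρ , λ where
          (pr-if-own q₁' q₂') →
            if⪰ (simulate-idle st₁ w₁ sp₁ p∉ρ q₁ q₁') (simulate-idle st₂ w₂ sp₂ p∉ρ q₂ q₂')
          (pr-if-oth p≢p _ _ _) → ⊥-elim (p≢p refl)
      simulate (s-delay-if _ st₁ st₂) (w₁ , w₂) (sp₁ , sp₂ , _) (pr-if-oth r≢p q₁ q₂ m) =
        localSimulation-merge r≢p m (simulate st₁ w₁ sp₁ q₁) (simulate st₂ w₂ sp₂ q₂)
      simulate (s-delay-rt ρ⊥ps _) _ _ (pr-rt-in r∈) =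
        _ , idle (λ r∈ρ → ρ⊥ps _ r∈ρ r∈) , proj-⪰ D _ (pr-rt-in r∈)
      simulate (s-delay-rt _ st) (_ , _ , w) (spC , _) (pr-rt-out r∉ q) =
        let B° , L , H = simulate st w spC q in B° , L , H ∘ proj-rtcall-idle D r∉
      simulate st@(s-call-one _ _ _) _ _ q = simulate-call st q
      simulate st@(s-call-many _ _ _) _ _ q = simulate-call st q
      simulate (s-rt-many _ p∈ _) (_ , ps⊆ , _) spC q = simulate-rt-many ps⊆ spC p∈ q
      simulate (s-rt-one _ p∈ len) (_ , ps⊆ , _) spC q = simulate-rt-one ps⊆ spC p∈ len q

      simulate-idle : ∀ {C s ρ C' s' r B B'} → CStep D C s ρ C' s' → rtcallWF D C → sp D C r →
        r ∉ procsR ρ → Proj D C r B → Proj D C' r B' → B ⪰ B'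
      simulate-idle st w spC r∉ q q' =
        let _ , L , H = simulate st w spC q in subst (_⪰ _) (sym (localStep-idle r∉ L)) (H q')

  epp-completeness : (P : Program) (s : State) (l : ObsLabel) (P' : Program) (s' : State) →
    StronglyProjectable P → ProgStep P s l P' s' →
    (E : ProcProgram) → IsEpp P E →
    Σ ProcProgram λ N → Σ ObsLabel λ l' →
      PConfStep E s l' N s' × proj₁ N ≡ proj₁ E ×
      (ProgProjectable P' → (E' : ProcProgram) → IsEpp P' E' → proj₂ N ⪰N proj₂ E')
  epp-completeness _ s _ _ s' ((noSelfC , rtcallWFC , wfD) , _ , spC)
                   (prog-step {D} {C} {ρ = ρ} {C'} step) (Df , N) (eppD , eppC) =
    (Df , N°) , forget ρ ,
    pconf-step (localSteps⇒pstep ρ (cstep-selfFree step noSelfC) (cstep-stateEffect step)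
                                  (λ r → proj₁ (proj₂ (sim r)))) ,
    refl ,
    λ _ (_ , N') (_ , eppC') r → proj₂ (proj₂ (sim r)) (proj-epp D C' N' eppC' r)
    where
      open Simulation D Df (λ X r → proj₁ (eppD X r)) (λ X → proj₂ (proj₂ (proj₂ (wfD X))))

      sim : ∀ r → LocalSimulation s ρ C' r (N r)
      sim r = simulate step rtcallWFC (spC r) (proj-epp D C N eppC r)

      N° : Network
      N° r = proj₁ (sim r)

mainTheorem1 : (σ : Sig) → let open Theory σ in
    (P : Program) (s : State) (l : ObsLabel) (P' : Program) (s' : State) →
    StronglyProjectable P → ProgStep P s l P' s' →
    (E : ProcProgram) → IsEpp P E →
    Σ ProcProgram λ N → Σ ObsLabel λ l' →
      PConfStep E s l' N s' × proj₁ N ≡ proj₁ E ×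
      (ProgProjectable P' → (E' : ProcProgram) → IsEpp P' E' → proj₂ N ⪰N proj₂ E')
mainTheorem1 = Completeness.epp-completeness
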